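{- Let $(A_\beta)_{\beta<\omega}$ be a partition of $\mathbb{N}$ into infinitely many nonempty pairwise disjoint sets, and let $\varphi$ be the coloring associated to it. Then for every finite $a\subseteq[\mathbb{N}]^2$ the finite change $\varphi_a$ is reconstructible.
   Context: A coloring on $\mathbb{N}$ is a function $\varphi:[\mathbb{N}]^2\to\{0,1\}$. The coloring associated to a partition $(A_\beta)_\beta$ is $\varphi(\{x,y\})=1$ iff $x,y\in A_\beta$ for some $\beta$. For finite $a\subseteq[\mathbb{N}]^2$, $\varphi_a(e)=\varphi(e)$ for $e\notin a$ and $\varphi_a(e)=1-\varphi(e)$ for $e\in a$. $\mathrm{hom}(\varphi)=\{H\subseteq\mathbb{N}:\ |H|>2 \text{ and } \varphi \text{ is constant on } [H]^2\}$. $\varphi$ is reconstructible if for every coloring $\psi$ on $\mathbb{N}$ with $\mathrm{hom}(\psi)=\mathrm{hom}(\varphi)$ one has $\psi=\varphi$ or $\psi=1-\varphi$. -}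

module Defs where

open import Data.Nat using (ℕ; _<_; _≡ᵇ_)
open import Data.Bool using (Bool; true; false; not; _∧_; _∨_; if_then_else_)
open import Data.Product using (_×_; _,_; Σ; ∃; ∃-syntax)
open import Data.Sum using (_⊎_; inj₁; inj₂)
open import Data.List using (List; []; _∷_)
open import Relation.Binary.PropositionalEquality using (_≡_; _≢_)
open import Function.Bundles using (_⇔_)
open import Level using (0ℓ; suc)

-- A coloring on ℕ: a map [ℕ]² → {0,1}.  Colors are Bool (false = 0,
-- true = 1).  An edge {x,y} with x < y is represented by the ordered
-- pair (x , y); only the values  c x y  with  x < y  are meaningful.
Coloring : Set
Coloring = ℕ → ℕ → Bool

_≈c_ : Coloring → Coloring → Set
φ ≈c ψ = ∀ x y → x < y → φ x y ≡ ψ x y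

compl : Coloring → Coloring
compl φ x y = not (φ x y)

-- A partition of ℕ into blocks (A_β)_{β<ω}, given by the block index
-- function: A_β = { x | blk x ≡ β }.  The blocks are automatically
-- pairwise disjoint and cover ℕ; all blocks nonempty ⇔ blk surjective.
AllBlocksNonempty : (ℕ → ℕ) → Set
AllBlocksNonempty blk = ∀ β → ∃[ x ] blk x ≡ β

assoc : (ℕ → ℕ) → Coloring
assoc blk x y = blk x ≡ᵇ blk y

-- A finite set a ⊆ [ℕ]² given as a list of pairs; a pair (u , v) stands
-- for the unordered edge {u , v} (either orientation is accepted).
FinEdges : Set
FinEdges = List (ℕ × ℕ)

inEdges : FinEdges → ℕ → ℕ → Bool
inEdges [] x y = false
inEdges ((u , v) ∷ a) x y =
  ((u ≡ᵇ x) ∧ (v ≡ᵇ y)) ∨ ((u ≡ᵇ y) ∧ (v ≡ᵇ x)) ∨ inEdges a x y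

change : Coloring → FinEdges → Coloring
change φ a x y = if inEdges a x y then not (φ x y) else φ x y

Subset : Set₁
Subset = ℕ → Set

AtLeast3 : Subset → Set
AtLeast3 H = ∃[ x ] ∃[ y ] ∃[ z ] (H x × H y × H z × x < y × y < z)

ConstOn : Coloring → Subset → Set
ConstOn φ H = ∃[ c ] (∀ x y → H x → H y → x < y → φ x y ≡ c)

InHom : Coloring → Subset → Set
InHom φ H = AtLeast3 H × ConstOn φ H

SameHom : Coloring → Coloring → Set₁
SameHom ψ φ = ∀ (H : Subset) → (InHom ψ H ⇔ InHom φ H)

Reconstructible : Coloring → Set₁
Reconstructible φ = ∀ (ψ : Coloring) → SameHom ψ φ → (ψ ≈c φ) ⊎ (ψ ≈c compl φ)

-- Far enough out, a finite change φ of the partition coloring looks like the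
-- original: outside the finitely many blocks touched by a, points of
-- different blocks get color 0.  Let ψ have the same homogeneous sets as φ,
-- and compare the two colorings on triangles.  A triangle z, w, x with
-- pairwise distinct blocks, z and w in fresh blocks, is 0-homogeneous for φ,
-- so ψ is constant on it; chaining such triangles shows that ψ takes one
-- value c on every pair {z, w} from distinct fresh blocks, and on {z, x}
-- whenever the block of z is fresh and above that of x.  For an edge {x, y}
-- and such a z, the triangle z, x, y is then φ-homogeneous iff φ(xy) = 0 and
-- ψ-homogeneous iff ψ(xy) = c, so ψ(xy) = c xor φ(xy) for every edge.
module Submission where

open import Defs
open import Data.Nat using (ℕ; suc; _<_; _⊔_; _≡ᵇ_)
open import Data.Nat.Properties
  using (_<?_; <-cmp; <-trans; <⇒≢; >⇒≢; n<1+n; ≡ᵇ⇒≡; m⊔n<o⇒m<o; m⊔n<o⇒n<o)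
open import Data.Bool using (Bool; true; false; _xor_; T)
open import Data.Bool.Properties using (¬-not; ∧-zeroʳ; xor-identityʳ; xor-comm)
open import Data.Product using (_×_; _,_; ∃-syntax; proj₁; proj₂)
open import Data.Sum using (_⊎_; inj₁; inj₂)
open import Data.List using ([]; _∷_)
open import Data.Empty using (⊥-elim)
open import Relation.Nullary using (yes; no)
open import Relation.Binary using (tri<; tri≈; tri>)
open import Relation.Binary.PropositionalEquality
  using (_≡_; _≢_; refl; sym; trans; cong; cong₂; subst; ≢-sym; module ≡-Reasoning)
open import Function.Bundles using (_⇔_; mk⇔; Equivalence)

-- A coloring only carries information above the diagonal; this reads it
-- as a function on unordered pairs.
unordered : Coloring → ℕ → ℕ → Bool
unordered χ p q with p <? q
... | yes _ = χ p q
... | no _ = χ q p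

unordered-< : ∀ χ {p q} → p < q → unordered χ p q ≡ χ p q
unordered-< χ {p} {q} p<q with p <? q
... | yes _ = refl
... | no p≮q = ⊥-elim (p≮q p<q)

unordered-> : ∀ χ {p q} → q < p → unordered χ p q ≡ χ q p
unordered-> χ {p} {q} q<p with p <? q
... | yes p<q = ⊥-elim (<⇒≢ (<-trans p<q q<p) refl)
... | no _ = refl

unordered-comm : ∀ χ {p q} → p ≢ q → unordered χ p q ≡ unordered χ q p
unordered-comm χ {p} {q} p≢q with <-cmp p q
... | tri< p<q _ _ = trans (unordered-< χ p<q) (sym (unordered-> χ p<q))
... | tri≈ _ p≡q _ = ⊥-elim (p≢q p≡q)
... | tri> _ _ q<p = trans (unordered-> χ q<p) (sym (unordered-< χ q<p))

unordered-cases : ∀ χ p q → unordered χ p q ≡ χ p q ⊎ unordered χ p q ≡ χ q p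
unordered-cases χ p q with p <? q
... | yes _ = inj₁ refl
... | no _ = inj₂ refl

Monochromatic : Bool → Bool → Bool → Set
Monochromatic b₁ b₂ b₃ = (b₁ ≡ b₂) × (b₁ ≡ b₃)

monochromatic-apex : ∀ {a₁ a₂ a b₁ b₂ c} → a₁ ≡ false → a₂ ≡ false → b₁ ≡ b₂ →
  (Monochromatic a₁ a₂ a ⇔ Monochromatic b₁ b₂ c) → c ≡ b₁ xor a
monochromatic-apex {a = false} {b₁} refl refl refl h =
  trans (sym (proj₂ (Equivalence.to h (refl , refl)))) (sym (xor-identityʳ b₁))
monochromatic-apex {a = true} {b₁} refl refl refl h =
  trans (¬-not λ c≡b₁ → false≢true (proj₂ (Equivalence.from h (refl , sym c≡b₁))))
        (xor-comm true b₁)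
  where
  false≢true : false ≢ true
  false≢true ()

Triangle : ℕ → ℕ → ℕ → Subset
Triangle p q r n = n ≡ p ⊎ n ≡ q ⊎ n ≡ r

Distinct3 : ℕ → ℕ → ℕ → Set
Distinct3 p q r = (p ≢ q) × (p ≢ r) × (q ≢ r)

atLeast3-insert : ∀ {H : Subset} {m n r} → m < n → H m → H n → H r →
  r ≢ m → r ≢ n → AtLeast3 H
atLeast3-insert {m = m} {n} {r} m<n hm hn hr r≢m r≢n with <-cmp r m | <-cmp r n
... | tri< r<m _ _ | _ = r , m , n , hr , hm , hn , r<m , m<n
... | tri≈ _ r≡m _ | _ = ⊥-elim (r≢m r≡m)
... | tri> _ _ m<r | tri< r<n _ _ = m , r , n , hm , hr , hn , m<r , r<n
... | tri> _ _ _ | tri≈ _ r≡n _ = ⊥-elim (r≢n r≡n)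
... | tri> _ _ _ | tri> _ _ n<r = m , n , r , hm , hn , hr , m<n , n<r

triangle-atLeast3 : ∀ {p q r} → Distinct3 p q r → AtLeast3 (Triangle p q r)
triangle-atLeast3 {p} {q} {r} (p≢q , p≢r , q≢r) with <-cmp p q
... | tri< p<q _ _ = atLeast3-insert p<q (inj₁ refl) (inj₂ (inj₁ refl)) (inj₂ (inj₂ refl))
                       (≢-sym p≢r) (≢-sym q≢r)
... | tri≈ _ p≡q _ = ⊥-elim (p≢q p≡q)
... | tri> _ _ q<p = atLeast3-insert q<p (inj₂ (inj₁ refl)) (inj₁ refl) (inj₂ (inj₂ refl))
                       (≢-sym q≢r) (≢-sym p≢r)

module _ (χ : Coloring) {p q r : ℕ} (distinct : Distinct3 p q r) where

  private
    p≢q = proj₁ distinct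
    p≢r = proj₁ (proj₂ distinct)
    q≢r = proj₂ (proj₂ distinct)

  constOn-triangle⇒monochromatic : ConstOn χ (Triangle p q r) →
    Monochromatic (unordered χ p q) (unordered χ p r) (unordered χ q r)
  constOn-triangle⇒monochromatic (c , const) =
    trans pq (sym pr) , trans pq (sym qr)
    where
    edge : ∀ {u v} → u ≢ v → Triangle p q r u → Triangle p q r v → unordered χ u v ≡ c
    edge {u} {v} u≢v hu hv with <-cmp u v
    ... | tri< u<v _ _ = trans (unordered-< χ u<v) (const u v hu hv u<v)
    ... | tri≈ _ u≡v _ = ⊥-elim (u≢v u≡v)
    ... | tri> _ _ v<u = trans (unordered-> χ v<u) (const v u hv hu v<u)
    pq = edge p≢q (inj₁ refl) (inj₂ (inj₁ refl))
    pr = edge p≢r (inj₁ refl) (inj₂ (inj₂ refl))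
    qr = edge q≢r (inj₂ (inj₁ refl)) (inj₂ (inj₂ refl))

  monochromatic⇒constOn-triangle :
    Monochromatic (unordered χ p q) (unordered χ p r) (unordered χ q r) →
    ConstOn χ (Triangle p q r)
  monochromatic⇒constOn-triangle (pq≡pr , pq≡qr) =
    unordered χ p q ,
    λ x y hx hy x<y → trans (sym (unordered-< χ x<y)) (edge hx hy (<⇒≢ x<y))
    where
    edge : ∀ {u v} → Triangle p q r u → Triangle p q r v → u ≢ v →
           unordered χ u v ≡ unordered χ p q
    edge (inj₁ refl) (inj₁ refl) u≢v = ⊥-elim (u≢v refl)
    edge (inj₁ refl) (inj₂ (inj₁ refl)) _ = refl
    edge (inj₁ refl) (inj₂ (inj₂ refl)) _ = sym pq≡pr
    edge (inj₂ (inj₁ refl)) (inj₁ refl) u≢v = unordered-comm χ u≢v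
    edge (inj₂ (inj₁ refl)) (inj₂ (inj₁ refl)) u≢v = ⊥-elim (u≢v refl)
    edge (inj₂ (inj₁ refl)) (inj₂ (inj₂ refl)) _ = sym pq≡qr
    edge (inj₂ (inj₂ refl)) (inj₁ refl) u≢v = trans (unordered-comm χ u≢v) (sym pq≡pr)
    edge (inj₂ (inj₂ refl)) (inj₂ (inj₁ refl)) u≢v = trans (unordered-comm χ u≢v) (sym pq≡qr)
    edge (inj₂ (inj₂ refl)) (inj₂ (inj₂ refl)) u≢v = ⊥-elim (u≢v refl)

  inHom-triangle⇔monochromatic : InHom χ (Triangle p q r) ⇔
    Monochromatic (unordered χ p q) (unordered χ p r) (unordered χ q r)
  inHom-triangle⇔monochromatic = mk⇔
    (λ (_ , const) → constOn-triangle⇒monochromatic const)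
    (λ mono → triangle-atLeast3 distinct , monochromatic⇒constOn-triangle mono)

module SameTriangles {φ ψ : Coloring} (same : SameHom ψ φ) where

  φ̂ ψ̂ : ℕ → ℕ → Bool
  φ̂ = unordered φ
  ψ̂ = unordered ψ

  monochromatic⇔ : ∀ {p q r} → Distinct3 p q r →
    Monochromatic (φ̂ p q) (φ̂ p r) (φ̂ q r) ⇔ Monochromatic (ψ̂ p q) (ψ̂ p r) (ψ̂ q r)
  monochromatic⇔ {p} {q} {r} distinct = mk⇔
    (λ m → to ψ-side (from (same (Triangle p q r)) (from φ-side m)))
    (λ m → to φ-side (to (same (Triangle p q r)) (from ψ-side m)))
    where
    open Equivalence
    φ-side = inHom-triangle⇔monochromatic φ distinct
    ψ-side = inHom-triangle⇔monochromatic ψ distinct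

  zero-triangle : ∀ {p q r} → Distinct3 p q r →
    φ̂ p q ≡ false → φ̂ p r ≡ false → φ̂ q r ≡ false →
    Monochromatic (ψ̂ p q) (ψ̂ p r) (ψ̂ q r)
  zero-triangle distinct pq pr qr =
    Equivalence.to (monochromatic⇔ distinct) (trans pq (sym pr) , trans pq (sym qr))

  apex : ∀ {z x y} → Distinct3 z x y →
    φ̂ z x ≡ false → φ̂ z y ≡ false → ψ̂ z x ≡ ψ̂ z y → ψ̂ x y ≡ ψ̂ z x xor φ̂ x y
  apex distinct φzx φzy ψzx≡ψzy =
    monochromatic-apex φzx φzy ψzx≡ψzy (monochromatic⇔ distinct)

xor-constant⇒reconstructed : ∀ {φ ψ} b → (∀ x y → x < y → ψ x y ≡ b xor φ x y) →
  (ψ ≈c φ) ⊎ (ψ ≈c compl φ)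
xor-constant⇒reconstructed false h = inj₁ h
xor-constant⇒reconstructed true h = inj₂ h

≢⇒≡ᵇ-false : ∀ {m n} → m ≢ n → (m ≡ᵇ n) ≡ false
≢⇒≡ᵇ-false {m} {n} m≢n = ¬-not λ eq → m≢n (≡ᵇ⇒≡ m n (subst T (sym eq) _))

inEdges-∷-avoiding : ∀ {u v p} e q → u ≢ p → v ≢ p →
  inEdges e p q ≡ false × inEdges e q p ≡ false →
  inEdges ((u , v) ∷ e) p q ≡ false × inEdges ((u , v) ∷ e) q p ≡ false
inEdges-∷-avoiding {u} e q u≢p v≢p (epq≡false , eqp≡false)
  rewrite ≢⇒≡ᵇ-false u≢p | ≢⇒≡ᵇ-false v≢p | ∧-zeroʳ (u ≡ᵇ q) | epq≡false | eqp≡false =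
  refl , refl

module FiniteChange (blk : ℕ → ℕ) (surj : AllBlocksNonempty blk) (a : FinEdges) where

  φ : Coloring
  φ = change (assoc blk) a

  blockBound : FinEdges → ℕ
  blockBound [] = 0
  blockBound ((u , v) ∷ e) = blk u ⊔ blk v ⊔ blockBound e

  blocks-≢ : ∀ {p q} → blk p ≢ blk q → p ≢ q
  blocks-≢ bp≢bq p≡q = bp≢bq (cong blk p≡q)

  inEdges-beyond : ∀ e {p} q → blockBound e < blk p →
    inEdges e p q ≡ false × inEdges e q p ≡ false
  inEdges-beyond [] q _ = refl , refl
  inEdges-beyond ((u , v) ∷ e) q h =
    inEdges-∷-avoiding e q (blocks-≢ (<⇒≢ u<p)) (blocks-≢ (<⇒≢ v<p)) (inEdges-beyond e q e<p)
    where
    uv<p = m⊔n<o⇒m<o (blk u ⊔ blk v) (blockBound e) h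
    u<p = m⊔n<o⇒m<o (blk u) (blk v) uv<p
    v<p = m⊔n<o⇒n<o (blk u) (blk v) uv<p
    e<p = m⊔n<o⇒n<o (blk u ⊔ blk v) (blockBound e) h

  Fresh : ℕ → Set
  Fresh z = blockBound a < blk z

  φ-fresh : ∀ {p q} → Fresh p → blk p ≢ blk q → φ p q ≡ false × φ q p ≡ false
  φ-fresh {p} {q} fresh bp≢bq
    rewrite proj₁ (inEdges-beyond a q fresh) | proj₂ (inEdges-beyond a q fresh) =
    ≢⇒≡ᵇ-false bp≢bq , ≢⇒≡ᵇ-false (≢-sym bp≢bq)

  φ̂-fresh : ∀ {p q} → Fresh p → blk p ≢ blk q → unordered φ p q ≡ false
  φ̂-fresh {p} {q} fresh bp≢bq with unordered-cases φ p q
  ... | inj₁ eq = trans eq (proj₁ (φ-fresh fresh bp≢bq))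
  ... | inj₂ eq = trans eq (proj₂ (φ-fresh fresh bp≢bq))

  blockAbove : ∀ n → ∃[ z ] n < blk z
  blockAbove n with surj (suc n)
  ... | z , bz≡1+n = z , subst (n <_) (sym bz≡1+n) (n<1+n n)

  freshPairAbove : ∀ n → ∃[ z ] ∃[ w ] n < blk z × blk z < blk w
  freshPairAbove n with blockAbove n
  ... | z , n<bz with blockAbove (blk z)
  ...   | w , bz<bw = z , w , n<bz , bz<bw

  module _ {ψ : Coloring} (same : SameHom ψ φ) where

    open SameTriangles same

    fresh-triangle : ∀ {p q r} → Fresh p → Fresh q →
      blk p ≢ blk q → blk p ≢ blk r → blk q ≢ blk r →
      Monochromatic (ψ̂ p q) (ψ̂ p r) (ψ̂ q r)
    fresh-triangle fp fq pq pr qr =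
      zero-triangle (blocks-≢ pq , blocks-≢ pr , blocks-≢ qr)
        (φ̂-fresh fp pq) (φ̂-fresh fp pr) (φ̂-fresh fq qr)

    ascending-triangle : ∀ {p q r} → Fresh p → blk p < blk q → blk q < blk r →
      Monochromatic (ψ̂ p q) (ψ̂ p r) (ψ̂ q r)
    ascending-triangle fp p<q q<r =
      fresh-triangle fp (<-trans fp p<q) (<⇒≢ p<q) (<⇒≢ (<-trans p<q q<r)) (<⇒≢ q<r)

    fresh-pairs-agree : ∀ {z w z′ w′} → Fresh z → blk z < blk w →
      Fresh z′ → blk z′ < blk w′ → ψ̂ z w ≡ ψ̂ z′ w′
    fresh-pairs-agree {z} {w} {z′} {w′} fz z<w fz′ z′<w′
      with blockAbove (blk w ⊔ blk w′)
    ... | t , ww′<t with blockAbove (blk t)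
    ...   | u , t<u = trans (via-tu fz z<w w<t) (sym (via-tu fz′ z′<w′ w′<t))
      where
      w<t = m⊔n<o⇒m<o (blk w) (blk w′) ww′<t
      w′<t = m⊔n<o⇒n<o (blk w) (blk w′) ww′<t
      via-tu : ∀ {p q} → Fresh p → blk p < blk q → blk q < blk t → ψ̂ p q ≡ ψ̂ t u
      via-tu fp p<q q<t = trans (proj₁ (ascending-triangle fp p<q q<t))
                                (proj₂ (ascending-triangle fp (<-trans p<q q<t) t<u))

    edge-via-fresh-pair : ∀ {x y z w} → x ≢ y → Fresh z → blk x < blk z → blk y < blk z →
      blk z < blk w → ψ̂ x y ≡ ψ̂ z w xor φ̂ x y
    edge-via-fresh-pair {x} {y} {z} {w} x≢y fz x<z y<z z<w =
      trans (apex (blocks-≢ (>⇒≢ x<z) , blocks-≢ (>⇒≢ y<z) , x≢y)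
                  (φ̂-fresh fz (>⇒≢ x<z)) (φ̂-fresh fz (>⇒≢ y<z)) (trans (sym zw≡zx) zw≡zy))
            (cong (_xor φ̂ x y) (sym zw≡zx))
      where
      zw≡zx : ψ̂ z w ≡ ψ̂ z x
      zw≡zx = proj₁ (fresh-triangle fz (<-trans fz z<w)
                       (<⇒≢ z<w) (>⇒≢ x<z) (>⇒≢ (<-trans x<z z<w)))
      zw≡zy : ψ̂ z w ≡ ψ̂ z y
      zw≡zy = proj₁ (fresh-triangle fz (<-trans fz z<w)
                       (<⇒≢ z<w) (>⇒≢ y<z) (>⇒≢ (<-trans y<z z<w)))

    reconstructed : (ψ ≈c φ) ⊎ (ψ ≈c compl φ)
    reconstructed with freshPairAbove (blockBound a)
    ... | z₀ , w₀ , fz₀ , z₀<w₀ = xor-constant⇒reconstructed (ψ̂ z₀ w₀) edge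
      where
      edge : ∀ x y → x < y → ψ x y ≡ ψ̂ z₀ w₀ xor φ x y
      edge x y x<y with freshPairAbove (blockBound a ⊔ blk x ⊔ blk y)
      ... | z , w , bxy<z , z<w =
        begin
          ψ x y               ≡⟨ sym (unordered-< ψ x<y) ⟩
          ψ̂ x y               ≡⟨ edge-via-fresh-pair (<⇒≢ x<y) fz x<z y<z z<w ⟩
          ψ̂ z w xor φ̂ x y     ≡⟨ cong₂ _xor_ (fresh-pairs-agree fz z<w fz₀ z₀<w₀)
                                             (unordered-< φ x<y) ⟩
          ψ̂ z₀ w₀ xor φ x y   ∎
        where
        open ≡-Reasoning
        bx<z = m⊔n<o⇒m<o (blockBound a ⊔ blk x) (blk y) bxy<z
        fz = m⊔n<o⇒m<o (blockBound a) (blk x) bx<z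
        x<z = m⊔n<o⇒n<o (blockBound a) (blk x) bx<z
        y<z = m⊔n<o⇒n<o (blockBound a ⊔ blk x) (blk y) bxy<z

mainTheorem17 : (blk : ℕ → ℕ) → AllBlocksNonempty blk →
    (a : FinEdges) → Reconstructible (change (assoc blk) a)
mainTheorem17 blk surj a ψ same = FiniteChange.reconstructed blk surj a same
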